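{- Let $p=\underline{p_{1}p_{2}\ldots p_{r}}$ be a consecutive pattern and let $d=\max_{i}\{p_{i}\}$. Then the vincular patterns $(d{+}1)\underline{p_{1}p_{2}\ldots p_{r}}$ and $(d{+}1)\underline{p_{r}p_{r-1}\ldots p_{1}}$ are Wilf equivalent, i.e., for every $n$ the number of inversion sequences of length $n$ avoiding $(d{+}1)\underline{p_{1}p_{2}\ldots p_{r}}$ equals the number of inversion sequences of length $n$ avoiding $(d{+}1)\underline{p_{r}p_{r-1}\ldots p_{1}}$.
   Context: An inversion sequence of length $n$ is a sequence $e=e_1e_2\dots e_n$ of integers with $0\le e_i<i$ for all $i$. The reduction of an integer word $w$ is obtained by replacing every instance of the $i$th smallest entry of $w$ by $i-1$. A vincular pattern is a sequence $q=q_1q_2\dots q_s$ with $q_i\in\{0,1,\dots,s-1\}$, where a value $j>0$ appears only if $j-1$ appears, and in which some disjoint subsequences of two or more adjacent entries may be underlined. An inversion sequence $e$ contains $q$ if there is a subsequence $e_{i_1}e_{i_2}\dots e_{i_s}$ (with $i_1<\dots<i_s$) whose reduction is $q$ and such that $i_{t+1}=i_t+1$ whenever $q_t$ and $q_{t+1}$ belong to the same underlined block; otherwise $e$ avoids $q$. A consecutive pattern is one in which all entries are underlined as a single block. Two vincular patterns are Wilf equivalent if, for every $n$, they are avoided by the same number of inversion sequences of length $n$. In the patterns of the claim, the first entry $d+1$ is not underlined and the remaining $r$ entries form one underlined block. -}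

module Defs where

open import Data.Nat using (ℕ; zero; suc; _<_; _≤_; _⊔_; _∸_)
open import Data.Nat.Properties using (_≟_)
open import Data.Fin using (Fin; toℕ)
open import Data.List using (List; []; _∷_; length; map; filter; upTo; lookup; foldr; replicate; reverse)
open import Data.List.Relation.Unary.Any using (any?)
open import Data.List.Relation.Unary.Linked using (Linked)
open import Data.List.Relation.Unary.Unique.Propositional using (Unique)
open import Data.List.Membership.Propositional using (_∈_)
open import Data.Bool using (Bool; true; false; T)
open import Data.Unit using (⊤)
open import Data.Product using (Σ; _×_)
open import Function.Bundles using (_⇔_)
open import Relation.Binary.PropositionalEquality using (_≡_)

-- e = e₁…eₙ is an inversion sequence of length n: 0 ≤ e_i < i (1-indexed),
-- i.e. the entry at 0-based position i is ≤ i.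
IsInvSeq : ℕ → List ℕ → Set
IsInvSeq n e = (length e ≡ n) × (∀ (i : Fin (length e)) → lookup e i ≤ toℕ i)

rank : List ℕ → ℕ → ℕ
rank w x = length (filter (λ v → any? (v ≟_) w) (upTo x))

reduce : List ℕ → List ℕ
reduce w = map (rank w) w

IsPattern : List ℕ → Set
IsPattern q = (∀ j → j ∈ q → j < length q) × (∀ j → suc j ∈ q → j ∈ q)

-- adjacency constraints: the t-th Bool says whether positions t and t+1 of the
-- occurrence must be adjacent (i.e. q_t q_{t+1} lie in the same underlined block)
AdjOK : {m : ℕ} → List Bool → List (Fin m) → Set
AdjOK (b ∷ bs) (i ∷ j ∷ is) = (T b → toℕ j ≡ suc (toℕ i)) × AdjOK bs (j ∷ is)
AdjOK _ _ = ⊤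

_<ᶠ_ : {m : ℕ} → Fin m → Fin m → Set
i <ᶠ j = toℕ i < toℕ j

Contains : List ℕ → List Bool → List ℕ → Set
Contains q adj e =
  Σ (List (Fin (length e))) λ is →
    (length is ≡ length q) × Linked _<ᶠ_ is × AdjOK adj is
      × (reduce (map (lookup e) is) ≡ q)

Avoids : List ℕ → List Bool → List ℕ → Set
Avoids q adj e = Contains q adj e → ⊥'
  where open import Data.Empty renaming (⊥ to ⊥')

-- adjacency data of a pattern x p₁…p_r where x is free and p₁…p_r is one
-- underlined block (r ≥ 1): first gap free, the remaining r-1 gaps adjacent.
headThenBlock : ℕ → List Bool
headThenBlock r = false ∷ replicate (r ∸ 1) true

HasCount : (List ℕ → Set) → ℕ → Set
HasCount P k = Σ (List (List ℕ)) λ L → Unique L × (∀ e → (e ∈ L) ⇔ P e) × (length L ≡ k)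

maxList : List ℕ → ℕ
maxList = foldr _⊔_ 0

module Submission where

-- Call an entry a record if it is at least every entry before it; the entries
-- between two consecutive records form a run lying strictly below the record
-- opening it.  flipRuns reverses every run in place.  It is an involution and
-- preserves inversion sequences (a moved entry stays after, and below, its record).
-- In an occurrence y·w of (d+1)·p the block w lies below y, hence inside one
-- run; flipRuns turns it into reverse w, preceded by the record z opening that
-- run, which is again above w.  The reduction of (entry above w)·(reverse w)
-- is (d+1)·reverse p, so flipRuns exchanges the two avoidance classes.

open import Defs
open import Data.Nat using (ℕ; zero; suc; _+_; _∸_; _<_; _≤_; _≥_; _≤?_; _<?_; z≤n; s≤s)
open import Data.Nat.Properties
open import Data.Bool using (Bool; true; false; T)
open import Data.Unit using (⊤; tt)
open import Data.Empty using (⊥-elim)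
open import Data.Product using (Σ; _×_; _,_; proj₁; proj₂)
open import Data.Sum using (_⊎_; inj₁; inj₂; [_,_]′)
open import Data.Fin using (Fin; toℕ) renaming (zero to fzero; suc to fsuc)
open import Data.Fin.Properties using (all?; toℕ<n)
open import Data.List
  using (List; []; _∷_; _++_; _ʳ++_; [_]; length; reverse; map; filter; lookup;
         take; drop; replicate; upTo; allFin; deduplicate; cartesianProductWith)
import Data.List.Properties as LP
open import Data.List.Membership.Propositional using (_∈_; lose)
open import Data.List.Membership.Propositional.Properties
  using (∈-∃++; ∈-++⁺ʳ; ∈-map⁺; ∈-map⁻; ∈-allFin; ∈-upTo⁺; ∈-filter⁺; ∈-filter⁻;
         ∈-deduplicate⁺; ∈-deduplicate⁻; ∈-cartesianProductWith⁺)
open import Data.List.Relation.Unary.Any as Any using (here; there; any?)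
open import Data.List.Relation.Unary.Any.Properties using (reverse⁺; reverse⁻; lookup-index)
open import Data.List.Relation.Unary.All as All using (All; []; _∷_)
open import Data.List.Relation.Unary.Linked using (Linked; []; [-]; _∷_; linked?)
open import Data.List.Relation.Unary.Unique.Propositional.Properties using (map⁺)
open import Data.List.Relation.Unary.Unique.DecPropositional.Properties (LP.≡-dec _≟_)
  using (deduplicate-!)
open import Function.Base using (_∘_)
open import Function.Bundles using (Equivalence; mk⇔)
open import Relation.Nullary using (Dec; yes; no)
open import Relation.Nullary.Decidable using (_×-dec_; map′; ¬?)
open import Relation.Binary.PropositionalEquality
  using (_≡_; refl; sym; trans; cong; cong₂; subst; subst₂; module ≡-Reasoning)

-- flipFrom m acc s: m is the current record, acc the entries read since it
-- (all below m) in reverse order; at the next record the run is emitted.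
flipFrom : ℕ → List ℕ → List ℕ → List ℕ
flipFrom m acc [] = acc
flipFrom m acc (x ∷ xs) with m ≤? x
... | yes _ = acc ++ x ∷ flipFrom x [] xs
... | no _ = flipFrom m (x ∷ acc) xs

-- Start with record 0: every first entry is a record.
flipRuns : List ℕ → List ℕ
flipRuns = flipFrom 0 []

flipFrom-record : ∀ {m x} acc xs → m ≤ x → flipFrom m acc (x ∷ xs) ≡ acc ++ x ∷ flipFrom x [] xs
flipFrom-record {m} {x} acc xs m≤x with m ≤? x
... | yes _ = refl
... | no m≰x = ⊥-elim (m≰x m≤x)

flipFrom-below : ∀ {m x} acc xs → x < m → flipFrom m acc (x ∷ xs) ≡ flipFrom m (x ∷ acc) xs
flipFrom-below {m} {x} acc xs x<m with m ≤? x
... | yes m≤x = ⊥-elim (<⇒≱ x<m m≤x)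
... | no _ = refl

flipFrom-run : ∀ {m} acc w c → All (_< m) w → flipFrom m acc (w ++ c) ≡ flipFrom m (w ʳ++ acc) c
flipFrom-run acc [] c [] = refl
flipFrom-run acc (x ∷ w) c (x<m ∷ w<m) =
  trans (flipFrom-below acc (w ++ c) x<m) (flipFrom-run (x ∷ acc) w c w<m)

flipFrom-twice : ∀ m acc s → All (_< m) acc → flipFrom m [] (flipFrom m acc s) ≡ acc ʳ++ s
flipFrom-twice m acc [] acc<m =
  trans (cong (flipFrom m []) (sym (LP.++-identityʳ acc))) (flipFrom-run [] acc [] acc<m)
flipFrom-twice m acc (x ∷ s) acc<m with m ≤? x
... | no m≰x = flipFrom-twice m (x ∷ acc) s (≰⇒> m≰x ∷ acc<m)
... | yes m≤x = begin
  flipFrom m [] (acc ++ x ∷ flipFrom x [] s)          ≡⟨ flipFrom-run [] acc _ acc<m ⟩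
  flipFrom m (reverse acc) (x ∷ flipFrom x [] s)      ≡⟨ flipFrom-record _ _ m≤x ⟩
  reverse acc ++ x ∷ flipFrom x [] (flipFrom x [] s)  ≡⟨ cong (λ t → reverse acc ++ x ∷ t) (flipFrom-twice x [] s []) ⟩
  reverse acc ++ x ∷ s                                ≡⟨ sym (LP.ʳ++-defn acc) ⟩
  acc ʳ++ (x ∷ s)                                     ∎
  where open ≡-Reasoning

flipRuns-involutive : ∀ e → flipRuns (flipRuns e) ≡ e
flipRuns-involutive e = flipFrom-twice 0 [] e []

-- Bounded k l: the entry of l at position i is at most k + i.
-- Inversion sequences are exactly the words with Bounded 0.
Bounded : ℕ → List ℕ → Set
Bounded k [] = ⊤
Bounded k (x ∷ l) = x ≤ k × Bounded (suc k) l

bounded-lookup : ∀ {k} l → Bounded k l → ∀ i → lookup l i ≤ k + toℕ i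
bounded-lookup {k} (x ∷ l) (x≤k , _) fzero = subst (x ≤_) (sym (+-identityʳ k)) x≤k
bounded-lookup {k} (x ∷ l) (_ , bl) (fsuc i) =
  subst (lookup l i ≤_) (sym (+-suc k (toℕ i))) (bounded-lookup l bl i)

lookup-bounded : ∀ {k} l → (∀ i → lookup l i ≤ k + toℕ i) → Bounded k l
lookup-bounded [] _ = tt
lookup-bounded {k} (x ∷ l) f = subst (x ≤_) (+-identityʳ k) (f fzero) ,
  lookup-bounded l (λ i → subst (lookup l i ≤_) (+-suc k (toℕ i)) (f (fsuc i)))

bounded-uniform : ∀ {k} l → All (_≤ k) l → Bounded k l
bounded-uniform [] [] = tt
bounded-uniform (x ∷ l) (x≤k ∷ l≤k) = x≤k , bounded-uniform l (All.map m≤n⇒m≤1+n l≤k)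

bounded-++ : ∀ {k} a {b} → Bounded k a → Bounded (k + length a) b → Bounded k (a ++ b)
bounded-++ {k} [] _ bb = subst (λ j → Bounded j _) (+-identityʳ k) bb
bounded-++ {k} (x ∷ a) {b} (x≤k , ba) bb =
  x≤k , bounded-++ a ba (subst (λ j → Bounded j b) (+-suc k (length a)) bb)

-- Entries of a run are moved only within the run, which starts after its
-- record m and lies below it; so with m ≤ k the output stays Bounded k.
flipFrom-bounded : ∀ m acc s k → All (_< m) acc → m ≤ k →
  Bounded (k + length acc) s → Bounded k (flipFrom m acc s)
flipFrom-bounded m acc [] k acc<m m≤k _ =
  bounded-uniform acc (All.map (λ x<m → ≤-trans (<⇒≤ x<m) m≤k) acc<m)
flipFrom-bounded m acc (x ∷ s) k acc<m m≤k (x≤ , bs) with m ≤? x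
... | yes _ = bounded-++ acc (bounded-uniform acc (All.map (λ x<m → ≤-trans (<⇒≤ x<m) m≤k) acc<m))
  (x≤ , flipFrom-bounded x [] s (suc (k + length acc)) [] (m≤n⇒m≤1+n x≤)
          (subst (λ j → Bounded j s) (sym (+-identityʳ _)) bs))
... | no m≰x = flipFrom-bounded m (x ∷ acc) s k (≰⇒> m≰x ∷ acc<m) m≤k
  (subst (λ j → Bounded j s) (sym (+-suc k (length acc))) bs)

length-flipFrom : ∀ m acc s → length (flipFrom m acc s) ≡ length acc + length s
length-flipFrom m acc [] = sym (+-identityʳ _)
length-flipFrom m acc (x ∷ s) with m ≤? x
... | yes _ = trans (LP.length-++ acc) (cong (λ j → length acc + suc j) (length-flipFrom x [] s))
... | no _ = trans (length-flipFrom m (x ∷ acc) s) (sym (+-suc (length acc) (length s)))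

flipRuns-invSeq : ∀ {n} e → IsInvSeq n e → IsInvSeq n (flipRuns e)
flipRuns-invSeq e (len , bound) = trans (length-flipFrom 0 [] e) len ,
  bounded-lookup (flipRuns e) (flipFrom-bounded 0 [] e 0 [] z≤n (lookup-bounded e bound))

flipFrom-emits-acc : ∀ m acc c → Σ (List ℕ) λ u → Σ (List ℕ) λ v → flipFrom m acc c ≡ u ++ acc ++ v
flipFrom-emits-acc m acc [] = [] , [] , sym (LP.++-identityʳ acc)
flipFrom-emits-acc m acc (x ∷ c) with m ≤? x
... | yes _ = [] , x ∷ flipFrom x [] c , refl
... | no _ with flipFrom-emits-acc m (x ∷ acc) c
... | u , v , eq = u ++ [ x ] , v , trans eq (sym (LP.++-assoc u [ x ] (acc ++ v)))

-- Invariant of the scan below: some entry above the block w is either the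
-- current record m or still unread (in t).  Reading one entry keeps it.
DominatedBy : ℕ → List ℕ → List ℕ → Set
DominatedBy m t w = Σ ℕ λ y → (y ≡ m ⊎ y ∈ t) × All (_< y) w

dominated-after-record : ∀ {m x t w} → m ≤ x → DominatedBy m (x ∷ t) w → DominatedBy x t w
dominated-after-record {x = x} m≤x (_ , inj₁ refl , w<y) = x , inj₁ refl , All.map (λ v<y → <-≤-trans v<y m≤x) w<y
dominated-after-record {x = x} _ (_ , inj₂ (here refl) , w<y) = x , inj₁ refl , w<y
dominated-after-record _ (y , inj₂ (there y∈t) , w<y) = y , inj₂ y∈t , w<y

dominated-after-below : ∀ {m x t w} → x < m → DominatedBy m (x ∷ t) w → DominatedBy m t w
dominated-after-below {m} _ (_ , inj₁ refl , w<y) = m , inj₁ refl , w<y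
dominated-after-below {m} x<m (_ , inj₂ (here refl) , w<y) = m , inj₁ refl , All.map (λ v<x → <-trans v<x x<m) w<y
dominated-after-below _ (y , inj₂ (there y∈t) , w<y) = y , inj₂ y∈t , w<y

flipFrom-reverses-block : ∀ m acc t w c → DominatedBy m t w →
  Σ (List ℕ) λ P → Σ (List ℕ) λ Q → Σ ℕ λ z →
    (flipFrom m acc (t ++ w ++ c) ≡ P ++ reverse w ++ Q) × All (_< z) w × (z ≡ m ⊎ z ∈ P)
flipFrom-reverses-block m acc [] w c (_ , inj₁ refl , w<m) with flipFrom-emits-acc m (w ʳ++ acc) c
... | u , v , eq = u , acc ++ v , m , emitted , w<m , inj₁ refl
  where
  open ≡-Reasoning
  emitted : flipFrom m acc (w ++ c) ≡ u ++ reverse w ++ acc ++ v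
  emitted = begin
    flipFrom m acc (w ++ c)        ≡⟨ flipFrom-run acc w c w<m ⟩
    flipFrom m (w ʳ++ acc) c       ≡⟨ eq ⟩
    u ++ (w ʳ++ acc) ++ v          ≡⟨ cong (λ r → u ++ r ++ v) (LP.ʳ++-defn w) ⟩
    u ++ (reverse w ++ acc) ++ v   ≡⟨ cong (u ++_) (LP.++-assoc (reverse w) acc v) ⟩
    u ++ reverse w ++ acc ++ v     ∎
flipFrom-reverses-block m acc (x ∷ t) w c dom with m ≤? x
... | no m≰x = flipFrom-reverses-block m (x ∷ acc) t w c (dominated-after-below (≰⇒> m≰x) dom)
... | yes m≤x with flipFrom-reverses-block x [] t w c (dominated-after-record m≤x dom)
... | P , Q , z , eq , w<z , z∈ = acc ++ x ∷ P , Q , z ,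
  trans (cong (λ r → acc ++ x ∷ r) eq) (sym (LP.++-assoc acc (x ∷ P) _)) , w<z ,
  inj₂ (∈-++⁺ʳ acc ([ here , there ]′ z∈))

flipRuns-reverses-block : ∀ a y b w0 w c → All (_< y) (w0 ∷ w) →
  Σ (List ℕ) λ P₁ → Σ ℕ λ z → Σ (List ℕ) λ P₂ → Σ (List ℕ) λ Q →
    (flipRuns (a ++ y ∷ b ++ (w0 ∷ w) ++ c) ≡ P₁ ++ z ∷ P₂ ++ reverse (w0 ∷ w) ++ Q)
    × All (_< z) (w0 ∷ w)
flipRuns-reverses-block a y b w0 w c w<y
  with flipFrom-reverses-block 0 [] (a ++ y ∷ b) (w0 ∷ w) c (y , inj₂ (∈-++⁺ʳ a (here refl)) , w<y)
... | _ , _ , _ , _ , (w0<0 ∷ _) , inj₁ refl = ⊥-elim (n≮0 w0<0)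
... | P , Q , z , eq , w<z , inj₂ z∈P with ∈-∃++ z∈P
... | P₁ , P₂ , refl = P₁ , z , P₂ , Q ,
  trans (cong flipRuns (sym (LP.++-assoc a (y ∷ b) _))) (trans eq (LP.++-assoc P₁ (z ∷ P₂) _)) , w<z

indicator : {A : Set} → Dec A → ℕ
indicator (yes _) = 1
indicator (no _) = 0

rank-suc : ∀ l x → rank l (suc x) ≡ rank l x + indicator (any? (x ≟_) l)
rank-suc l x = begin
  length (filter P (upTo (suc x)))                  ≡⟨ cong (λ u → length (filter P u)) (sym (LP.upTo-∷ʳ x)) ⟩
  length (filter P (upTo x ++ [ x ]))               ≡⟨ cong length (LP.filter-++ P (upTo x) [ x ]) ⟩
  length (filter P (upTo x) ++ filter P [ x ])      ≡⟨ LP.length-++ (filter P (upTo x)) ⟩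
  length (filter P (upTo x)) + length (filter P [ x ]) ≡⟨ cong (rank l x +_) last ⟩
  rank l x + indicator (any? (x ≟_) l)              ∎
  where
  open ≡-Reasoning
  P = λ v → any? (v ≟_) l
  last : length (filter P [ x ]) ≡ indicator (any? (x ≟_) l)
  last with any? (x ≟_) l
  ... | yes _ = refl
  ... | no _ = refl

rank-grows : ∀ l y k → rank l y ≤ rank l (k + y)
rank-grows l y zero = ≤-refl
rank-grows l y (suc k) =
  ≤-trans (rank-grows l y k) (subst (rank l (k + y) ≤_) (sym (rank-suc l (k + y))) (m≤m+n _ _))

rank-mono : ∀ l {y x} → y ≤ x → rank l y ≤ rank l x
rank-mono l {y} {x} y≤x = subst (λ j → rank l y ≤ rank l j) (m∸n+n≡m y≤x) (rank-grows l y (x ∸ y))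

rank-ext : ∀ l l' x → (∀ v → v < x → v ∈ l → v ∈ l') → (∀ v → v < x → v ∈ l' → v ∈ l) →
  rank l x ≡ rank l' x
rank-ext l l' zero _ _ = refl
rank-ext l l' (suc x) to from = begin
  rank l (suc x)                           ≡⟨ rank-suc l x ⟩
  rank l x + indicator (any? (x ≟_) l)     ≡⟨ cong₂ _+_ (rank-ext l l' x (λ v lt → to v (m<n⇒m<1+n lt))
                                                                    (λ v lt → from v (m<n⇒m<1+n lt))) same ⟩
  rank l' x + indicator (any? (x ≟_) l')   ≡⟨ sym (rank-suc l' x) ⟩
  rank l' (suc x)                          ∎
  where
  open ≡-Reasoning
  same : indicator (any? (x ≟_) l) ≡ indicator (any? (x ≟_) l')
  same with any? (x ≟_) l | any? (x ≟_) l'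
  ... | yes _ | yes _ = refl
  ... | no _ | no _ = refl
  ... | yes x∈l | no x∉l' = ⊥-elim (x∉l' (to x (n<1+n x) x∈l))
  ... | no x∉l | yes x∈l' = ⊥-elim (x∉l (from x (n<1+n x) x∈l'))

rank-saturates : ∀ l x k → All (_< x) l → rank l x ≡ rank l (k + x)
rank-saturates l x zero _ = refl
rank-saturates l x (suc k) l<x with any? ((k + x) ≟_) l | rank-suc l (k + x)
... | yes k+x∈l | _ = ⊥-elim (<⇒≱ (All.lookup l<x k+x∈l) (m≤n+m x k))
... | no _ | eq = trans (rank-saturates l x k l<x) (sym (trans eq (+-identityʳ _)))

∈-tail-below : ∀ {y v} w → v < y → v ∈ y ∷ w → v ∈ w
∈-tail-below w v<y (here refl) = ⊥-elim (<-irrefl refl v<y)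
∈-tail-below w _ (there v∈w) = v∈w

-- An entry above the block, followed by the block in either order, has the
-- same rank as any other entry above the block: the number of values of w.
rank-of-top : ∀ {y y'} w → All (_< y) w → All (_< y') w → rank (y' ∷ reverse w) y' ≡ rank (y ∷ w) y
rank-of-top {y} {y'} w w<y w<y' = begin
  rank (y' ∷ reverse w) y'  ≡⟨ rank-ext _ w y' (λ v lt m → reverse⁻ (∈-tail-below (reverse w) lt m))
                                              (λ _ _ m → there (reverse⁺ m)) ⟩
  rank w y'                 ≡⟨ rank-saturates w y' y w<y' ⟩
  rank w (y + y')           ≡⟨ cong (rank w) (+-comm y y') ⟩
  rank w (y' + y)           ≡⟨ sym (rank-saturates w y y' w<y) ⟩
  rank w y                  ≡⟨ rank-ext w _ y (λ _ _ m → there m) (λ v lt m → ∈-tail-below w lt m) ⟩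
  rank (y ∷ w) y            ∎
  where open ≡-Reasoning

rank-below-top : ∀ {y y' v} w → v < y → v < y' → rank (y' ∷ reverse w) v ≡ rank (y ∷ w) v
rank-below-top w v<y v<y' = rank-ext _ _ _
  (λ u u<v m → there (reverse⁻ (∈-tail-below (reverse w) (<-trans u<v v<y') m)))
  (λ u u<v m → there (reverse⁺ (∈-tail-below w (<-trans u<v v<y) m)))

reduce-head-dominates : ∀ y w z p → reduce (y ∷ w) ≡ z ∷ p → All (_< z) p → All (_< y) w
reduce-head-dominates y w z p eq p<z = All.tabulate λ {v} v∈w →
  ≰⇒> λ y≤v → <⇒≱ (All.lookup p<z (rank∈p v∈w))
                  (subst (_≤ rank (y ∷ w) v) (proj₁ (LP.∷-injective eq)) (rank-mono (y ∷ w) y≤v))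
  where
  rank∈p : ∀ {v} → v ∈ w → rank (y ∷ w) v ∈ p
  rank∈p v∈w = subst (_ ∈_) (proj₂ (LP.∷-injective eq)) (∈-map⁺ (rank (y ∷ w)) v∈w)

reduce-reverse-tail : ∀ y y' w z p → reduce (y ∷ w) ≡ z ∷ p → All (_< y) w → All (_< y') w →
  reduce (y' ∷ reverse w) ≡ z ∷ reverse p
reduce-reverse-tail y y' w z p eq w<y w<y' =
  cong₂ _∷_ (trans (rank-of-top w w<y w<y') (proj₁ (LP.∷-injective eq))) tail
  where
  open ≡-Reasoning
  tail : map (rank (y' ∷ reverse w)) (reverse w) ≡ reverse p
  tail = begin
    map (rank (y' ∷ reverse w)) (reverse w)  ≡⟨ LP.reverse-map (rank (y' ∷ reverse w)) w ⟩
    reverse (map (rank (y' ∷ reverse w)) w)  ≡⟨ cong reverse (LP.map-cong-local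
         (All.tabulate λ v∈w → rank-below-top w (All.lookup w<y v∈w) (All.lookup w<y' v∈w))) ⟩
    reverse (map (rank (y ∷ w)) w)           ≡⟨ cong reverse (proj₂ (LP.∷-injective eq)) ⟩
    reverse p                                ∎

OccursAt : (l : List ℕ) → List Bool → List ℕ → List (Fin (length l)) → Set
OccursAt l adj ws is = Linked _<ᶠ_ is × AdjOK adj is × (map (lookup l) is ≡ ws)

Occurs : List Bool → List ℕ → List ℕ → Set
Occurs adj ws l = Σ (List (Fin (length l))) (OccursAt l adj ws)

contains-of-occurs : ∀ {q adj ws e} → Occurs adj ws e → reduce ws ≡ q → Contains q adj e
contains-of-occurs {ws = ws} (is , increasing , adjacent , reads) red =
  is , trans (sym (LP.length-map _ is)) (trans (cong length reads)
         (trans (sym (LP.length-map (rank ws) ws)) (cong length red))) ,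
  increasing , adjacent , trans (cong reduce reads) red

occurs-shift : ∀ {adj ws l is} x → OccursAt l adj ws is → OccursAt (x ∷ l) adj ws (map fsuc is)
occurs-shift {adj = adj} {l = l} {is = is} x (increasing , adjacent , reads) =
  shift-linked increasing , shift-adj adj is adjacent , trans (shift-lookup is) reads
  where
  shift-linked : ∀ {js : List (Fin (length l))} → Linked _<ᶠ_ js → Linked _<ᶠ_ (map fsuc js)
  shift-linked [] = []
  shift-linked [-] = [-]
  shift-linked (i<j ∷ rest) = s≤s i<j ∷ shift-linked rest
  shift-adj : ∀ bs (js : List (Fin (length l))) → AdjOK bs js → AdjOK bs (map fsuc js)
  shift-adj [] _ _ = tt
  shift-adj (b ∷ bs) [] _ = tt
  shift-adj (b ∷ bs) (i ∷ []) _ = tt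
  shift-adj (b ∷ bs) (i ∷ j ∷ js) (next , rest) = (λ t → cong suc (next t)) , shift-adj bs (j ∷ js) rest
  shift-lookup : ∀ js → map (lookup (x ∷ l)) (map fsuc js) ≡ map (lookup l) js
  shift-lookup [] = refl
  shift-lookup (j ∷ js) = cong (lookup l j ∷_) (shift-lookup js)

occurs-prefix : ∀ {adj ws l} a → Occurs adj ws l → Occurs adj ws (a ++ l)
occurs-prefix [] occ = occ
occurs-prefix (x ∷ a) occ with occurs-prefix a occ
... | is , at = map fsuc is , occurs-shift x at

occurs-head : ∀ {adj ws l} y → Occurs adj ws l → Occurs (false ∷ adj) (y ∷ ws) (y ∷ l)
occurs-head y ([] , _ , _ , refl) = fzero ∷ [] , [-] , tt , refl
occurs-head {adj} {ws} {l} y (j ∷ js , at) = extend (occurs-shift y at)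
  where
  extend : OccursAt (y ∷ l) adj ws (map fsuc (j ∷ js)) → Occurs (false ∷ adj) (y ∷ ws) (y ∷ l)
  extend (increasing , adjacent , reads) =
    fzero ∷ fsuc j ∷ map fsuc js , s≤s z≤n ∷ increasing , ((λ ()) , adjacent) , cong (y ∷_) reads

occurs-initial : ∀ x w c → Σ (List (Fin (length (x ∷ w ++ c)))) λ js →
  OccursAt (x ∷ w ++ c) (replicate (length w) true) (x ∷ w) (fzero ∷ js)
occurs-initial x [] c = [] , [-] , tt , refl
occurs-initial x (x' ∷ w) c = extend (occurs-initial x' w c)
  where
  l = x' ∷ w ++ c
  extend : Σ (List (Fin (length l))) (λ js → OccursAt l (replicate (length w) true) (x' ∷ w) (fzero ∷ js)) →
    Σ (List (Fin (length (x ∷ l)))) λ js → OccursAt (x ∷ l) (replicate (length (x' ∷ w)) true) (x ∷ x' ∷ w) (fzero ∷ js)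
  extend (js , at) with occurs-shift x at
  ... | increasing , adjacent , reads =
    fsuc fzero ∷ map fsuc js , s≤s z≤n ∷ increasing , ((λ _ → refl) , adjacent) , cong (x ∷_) reads

occurs-block : ∀ w c → Occurs (replicate (length w ∸ 1) true) w (w ++ c)
occurs-block [] c = [] , [] , tt , refl
occurs-block (x ∷ w) c with occurs-initial x w c
... | js , at = fzero ∷ js , at

contains-of-split : ∀ a y b w c {z q} → reduce (y ∷ w) ≡ z ∷ q →
  Contains (z ∷ q) (headThenBlock (length q)) (a ++ y ∷ b ++ w ++ c)
contains-of-split a y b w c {z} {q} red =
  subst (λ k → Contains (z ∷ q) (false ∷ replicate (k ∸ 1) true) (a ++ y ∷ b ++ w ++ c)) same-length
    (contains-of-occurs {e = a ++ y ∷ b ++ w ++ c} occurrence red)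
  where
  occurrence : Occurs (false ∷ replicate (length w ∸ 1) true) (y ∷ w) (a ++ y ∷ b ++ w ++ c)
  occurrence = occurs-prefix a (occurs-head y (occurs-prefix b (occurs-block w c)))
  same-length : length w ≡ length q
  same-length = suc-injective (trans (sym (LP.length-map (rank (y ∷ w)) (y ∷ w))) (cong length red))

drop-lookup : ∀ (e : List ℕ) (j : Fin (length e)) → drop (toℕ j) e ≡ lookup e j ∷ drop (suc (toℕ j)) e
drop-lookup (x ∷ e) fzero = refl
drop-lookup (x ∷ e) (fsuc j) = drop-lookup e j

adjacent-window : ∀ (e : List ℕ) k (j : Fin (length e)) js → length js ≡ k →
  AdjOK (replicate k true) (j ∷ js) → map (lookup e) (j ∷ js) ≡ take (suc k) (drop (toℕ j) e)
adjacent-window e zero j [] _ _ = sym (cong (take 1) (drop-lookup e j))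
adjacent-window e (suc k) j (j' ∷ js) len (next , rest) = begin
  lookup e j ∷ map (lookup e) (j' ∷ js)            ≡⟨ cong (lookup e j ∷_) (adjacent-window e k j' js (suc-injective len) rest) ⟩
  lookup e j ∷ take (suc k) (drop (toℕ j') e)      ≡⟨ cong (λ t → lookup e j ∷ take (suc k) (drop t e)) (next tt) ⟩
  take (suc (suc k)) (lookup e j ∷ drop (suc (toℕ j)) e) ≡⟨ cong (take (suc (suc k))) (sym (drop-lookup e j)) ⟩
  take (suc (suc k)) (drop (toℕ j) e)              ∎
  where open ≡-Reasoning

lookup-∈-take : ∀ (e : List ℕ) (i : Fin (length e)) t → toℕ i < t → lookup e i ∈ take t e
lookup-∈-take (x ∷ e) fzero (suc t) _ = here refl
lookup-∈-take (x ∷ e) (fsuc i) (suc t) (s≤s i<t) = there (lookup-∈-take e i t i<t)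

split-of-contains : ∀ z p0 p' e → Contains (z ∷ p0 ∷ p') (headThenBlock (length (p0 ∷ p'))) e →
  Σ (List ℕ) λ a → Σ ℕ λ y → Σ (List ℕ) λ b → Σ ℕ λ w0 → Σ (List ℕ) λ w → Σ (List ℕ) λ c →
    (e ≡ a ++ y ∷ b ++ (w0 ∷ w) ++ c) × (reduce (y ∷ w0 ∷ w) ≡ z ∷ p0 ∷ p')
split-of-contains z p0 p' e (i ∷ j ∷ js , len , (i<j ∷ _) , (_ , adjacent) , red)
  with ∈-∃++ (lookup-∈-take e i (toℕ j) i<j)
... | a , b , before = a , lookup e i , b , lookup e j , map (lookup e) js , drop (suc k) D , shape , red
  where
  open ≡-Reasoning
  k = length p'
  D = drop (toℕ j) e
  W = map (lookup e) (j ∷ js)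
  window : W ≡ take (suc k) D
  window = adjacent-window e k j js (suc-injective (suc-injective len)) adjacent
  shape : e ≡ a ++ lookup e i ∷ b ++ W ++ drop (suc k) D
  shape = begin
    e                                                ≡⟨ sym (LP.take++drop≡id (toℕ j) e) ⟩
    take (toℕ j) e ++ D                              ≡⟨ cong (take (toℕ j) e ++_) (sym (LP.take++drop≡id (suc k) D)) ⟩
    take (toℕ j) e ++ (take (suc k) D ++ drop (suc k) D) ≡⟨ cong₂ (λ A B → A ++ (B ++ drop (suc k) D)) before (sym window) ⟩
    (a ++ [ lookup e i ] ++ b) ++ (W ++ drop (suc k) D)   ≡⟨ LP.++-assoc a _ _ ⟩
    a ++ lookup e i ∷ b ++ W ++ drop (suc k) D       ∎

occurrence-transfer : ∀ z p e → All (_< z) p → length p ≥ 1 →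
  Contains (z ∷ p) (headThenBlock (length p)) e →
  Contains (z ∷ reverse p) (headThenBlock (length p)) (flipRuns e)
occurrence-transfer z (p0 ∷ p') e p<z _ occ
  with split-of-contains z p0 p' e occ
... | a , y , b , w0 , w , c , refl , red
  with reduce-head-dominates y (w0 ∷ w) z (p0 ∷ p') red p<z
... | w<y with flipRuns-reverses-block a y b w0 w c w<y
... | P₁ , z' , P₂ , Q , flipped , w<z' =
  subst₂ (λ k l → Contains (z ∷ reverse (p0 ∷ p')) (headThenBlock k) l)
    (LP.length-reverse (p0 ∷ p')) (sym flipped)
    (contains-of-split P₁ z' P₂ (reverse (w0 ∷ w)) Q
      (reduce-reverse-tail y z' (w0 ∷ w) z (p0 ∷ p') red w<y w<z'))

occurrence-transfer-back : ∀ z p e → All (_< z) p → length p ≥ 1 →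
  Contains (z ∷ reverse p) (headThenBlock (length p)) e →
  Contains (z ∷ p) (headThenBlock (length p)) (flipRuns e)
occurrence-transfer-back z p e p<z len occ =
  subst₂ (λ r k → Contains (z ∷ r) (headThenBlock k) (flipRuns e))
    (LP.reverse-involutive p) (LP.length-reverse p)
    (occurrence-transfer z (reverse p) e rev<z (subst (_≥ 1) (sym (LP.length-reverse p)) len)
      (subst (λ k → Contains (z ∷ reverse p) (headThenBlock k) e) (sym (LP.length-reverse p)) occ))
  where
  rev<z : All (_< z) (reverse p)
  rev<z = All.tabulate (λ v∈rev → All.lookup p<z (reverse⁻ v∈rev))

-- Since flipRuns is an involution, a transfer of occurrences of q' into the
-- image turns avoidance of q into avoidance of q' in the image.
avoids-transfer : ∀ {q q' adj} → (∀ e → Contains q' adj e → Contains q adj (flipRuns e)) →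
  ∀ e → Avoids q adj e → Avoids q' adj (flipRuns e)
avoids-transfer {q} {adj = adj} transfer e avoids occ =
  avoids (subst (Contains q adj) (flipRuns-involutive e) (transfer (flipRuns e) occ))

words : {A : Set} → List A → ℕ → List (List A)
words I zero = [ [] ]
words I (suc s) = cartesianProductWith _∷_ I (words I s)

∈-words : ∀ {A : Set} (I : List A) xs → All (_∈ I) xs → xs ∈ words I (length xs)
∈-words I [] [] = here refl
∈-words I (x ∷ xs) (x∈I ∷ xs∈I) = ∈-cartesianProductWith⁺ _∷_ x∈I (∈-words I xs xs∈I)

adjOK? : ∀ {m} adj (is : List (Fin m)) → Dec (AdjOK adj is)
adjOK? [] _ = yes tt
adjOK? (b ∷ bs) [] = yes tt
adjOK? (b ∷ bs) (i ∷ []) = yes tt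
adjOK? (b ∷ bs) (i ∷ j ∷ is) = implied? b (toℕ j ≟ suc (toℕ i)) ×-dec adjOK? bs (j ∷ is)
  where
  implied? : ∀ b {X : Set} → Dec X → Dec (T b → X)
  implied? true d = map′ (λ x _ → x) (λ f → f tt) d
  implied? false _ = yes (λ ())

contains? : ∀ q adj e → Dec (Contains q adj e)
contains? q adj e with any? candidate? (words (allFin (length e)) (length q))
  where
  candidate? = λ is → (length is ≟ length q) ×-dec (linked? (λ i j → toℕ i <? toℕ j) is
    ×-dec (adjOK? adj is ×-dec LP.≡-dec _≟_ (reduce (map (lookup e) is)) q))
... | yes found = yes (Any.satisfied found)
... | no none = no λ { (is , rest) → none (lose (subst (λ s → is ∈ words _ s) (proj₁ rest)
        (∈-words _ is (All.tabulate λ {i} _ → ∈-allFin i))) rest) }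

isInvSeq? : ∀ n e → Dec (IsInvSeq n e)
isInvSeq? n e = (length e ≟ n) ×-dec all? (λ i → lookup e i ≤? toℕ i)

invSeq-enumerated : ∀ n e → IsInvSeq n e → e ∈ words (upTo n) n
invSeq-enumerated n e (refl , bound) = ∈-words (upTo (length e)) e (All.tabulate λ v∈e →
  ∈-upTo⁺ (subst (_< length e) (sym (lookup-index v∈e))
                 (≤-<-trans (bound (Any.index v∈e)) (toℕ<n (Any.index v∈e)))))

hasCount-enumerated : ∀ {P : List ℕ → Set} (U : List (List ℕ)) → (∀ e → Dec (P e)) →
  (∀ e → P e → e ∈ U) → Σ ℕ (HasCount P)
hasCount-enumerated {P} U P? complete =
  length L , L , deduplicate-! _ , (λ e → mk⇔ sound (λ h → ∈-deduplicate⁺ _ (∈-filter⁺ P? (complete e h) h))) , refl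
  where
  L = deduplicate (LP.≡-dec _≟_) (filter P? U)
  sound : ∀ {e} → e ∈ L → P e
  sound e∈L = proj₂ (∈-filter⁻ P? {xs = U} (∈-deduplicate⁻ _ (filter P? U) e∈L))

hasCount-involution : ∀ {P Q : List ℕ → Set} {k} (φ : List ℕ → List ℕ) → (∀ e → φ (φ e) ≡ e) →
  (∀ e → P e → Q (φ e)) → (∀ e → Q e → P (φ e)) → HasCount P k → HasCount Q k
hasCount-involution {P} {Q} φ involutive P→Q Q→P (L , unique , members , len) =
  map φ L , map⁺ injective unique , (λ e → mk⇔ sound complete) , trans (LP.length-map φ L) len
  where
  injective : ∀ {x y} → φ x ≡ φ y → x ≡ y
  injective {x} {y} eq = trans (sym (involutive x)) (trans (cong φ eq) (involutive y))
  sound : ∀ {e} → e ∈ map φ L → Q e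
  sound e∈ with ∈-map⁻ φ e∈
  ... | x , x∈L , refl = P→Q x (Equivalence.to (members x) x∈L)
  complete : ∀ {e} → Q e → e ∈ map φ L
  complete {e} qe = subst (_∈ map φ L) (involutive e) (∈-map⁺ φ (Equivalence.from (members (φ e)) (Q→P e qe)))

maxList-bound : ∀ p → All (_≤ maxList p) p
maxList-bound [] = []
maxList-bound (x ∷ p) = m≤m⊔n x _ ∷ All.map (λ h → ≤-trans h (m≤n⊔m x _)) (maxList-bound p)

theorem2p2 : (p : List ℕ) → IsPattern p → length p ≥ 1 →
    (n : ℕ) → Σ ℕ λ k →
    HasCount (λ e → IsInvSeq n e × Avoids (suc (maxList p) ∷ p) (headThenBlock (length p)) e) k
    × HasCount (λ e → IsInvSeq n e × Avoids (suc (maxList p) ∷ reverse p) (headThenBlock (length p)) e) k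
theorem2p2 p _ len≥1 n =
  k , avoiders , hasCount-involution flipRuns flipRuns-involutive to-reversed to-original avoiders
  where
  z = suc (maxList p)
  H = headThenBlock (length p)
  p<z : All (_< z) p
  p<z = All.map s≤s (maxList-bound p)
  counted : Σ ℕ (HasCount (λ e → IsInvSeq n e × Avoids (z ∷ p) H e))
  counted = hasCount-enumerated (words (upTo n) n)
    (λ e → isInvSeq? n e ×-dec ¬? (contains? (z ∷ p) H e)) (λ e → invSeq-enumerated n e ∘ proj₁)
  k = proj₁ counted
  avoiders = proj₂ counted
  to-reversed : ∀ e → IsInvSeq n e × Avoids (z ∷ p) H e → IsInvSeq n (flipRuns e) × Avoids (z ∷ reverse p) H (flipRuns e)
  to-reversed e (inv , avoids) = flipRuns-invSeq e inv ,
    avoids-transfer (λ e' → occurrence-transfer-back z p e' p<z len≥1) e avoids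
  to-original : ∀ e → IsInvSeq n e × Avoids (z ∷ reverse p) H e → IsInvSeq n (flipRuns e) × Avoids (z ∷ p) H (flipRuns e)
  to-original e (inv , avoids) = flipRuns-invSeq e inv ,
    avoids-transfer (λ e' → occurrence-transfer z p e' p<z len≥1) e avoids
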